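{- Let $H$ be a program hyperproperty, i.e. a set of sets of pairs of program states. Assume that the cardinality of $\mathit{LVars}$ is at least the cardinality of $\mathit{PVars}$ and that the cardinality of $\mathit{LVals}$ is at least the cardinality of $\mathit{PVals}$. Then there exist hyper-assertions $P$ and $Q$ such that, for every command $C$, $C$ satisfies $H$ if and only if $\models\{P\}C\{Q\}$.
   Context: Fix sets $\mathit{PVars}$, $\mathit{PVals}$ (program variables and values) and $\mathit{LVars}$, $\mathit{LVals}$ (logical variables and values). Program states are total functions $\sigma:\mathit{PVars}\to\mathit{PVals}$. Commands: $C ::= \mathbf{skip} \mid x:=e \mid x:=\mathrm{nonDet}() \mid \mathbf{assume}\ b \mid C;C \mid C+C \mid C^{*}$, with $x\in\mathit{PVars}$, $e$ a total function from program states to $\mathit{PVals}$, $b$ a total function from program states to Booleans. Big-step semantics $\langle C,\sigma\rangle\to\sigma'$ (inductive): $\langle\mathbf{skip},\sigma\rangle\to\sigma$; $\langle x:=e,\sigma\rangle\to\sigma[x\mapsto e(\sigma)]$; $\langle x:=\mathrm{nonDet}(),\sigma\rangle\to\sigma[x\mapsto v]$ for all $v$; $\langle\mathbf{assume}\ b,\sigma\rangle\to\sigma$ if $b(\sigma)$; sequential composition composes executions; $C_1+C_2$ executes either branch; $\langle C^*,\sigma\rangle\to\sigma$, and $\langle C^*,\sigma\rangle\to\sigma''$ whenever $\langle C,\sigma\rangle\to\sigma'$ and $\langle C^*,\sigma'\rangle\to\sigma''$. Extended states are pairs $\varphi=(\varphi^L,\varphi^P)$ with $\varphi^L:\mathit{LVars}\to\mathit{LVals}$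 and $\varphi^P$ a program state; $\mathit{sem}(C,S)=\{\varphi\mid\exists\sigma.(\varphi^L,\sigma)\in S\wedge\langle C,\sigma\rangle\to\varphi^P\}$. A hyper-assertion is a function from sets of extended states to Booleans; $\models\{P\}C\{Q\}$ iff for all sets $S$ of extended states, $P(S)$ implies $Q(\mathit{sem}(C,S))$. A program hyperproperty is an element of $\mathcal P(\mathcal P(\mathit{PStates}\times\mathit{PStates}))$; a command $C$ satisfies $H$ iff $\{(\sigma,\sigma')\mid\langle C,\sigma\rangle\to\sigma'\}\in H$. -}

module Defs where

open import Level using (0ℓ)
open import Data.Bool using (Bool; true)
open import Data.Product using (_×_; _,_; ∃; proj₁; proj₂)
open import Relation.Binary.PropositionalEquality using (_≡_)
open import Relation.Nullary using (¬_)
open import Relation.Unary using (Pred; _≐_)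

module HHL (PVars PVals LVars LVals : Set) where

  PState : Set
  PState = PVars → PVals

  LState : Set
  LState = LVars → LVals

  ExtState : Set
  ExtState = LState × PState

  Expr : Set
  Expr = PState → PVals

  BExpr : Set
  BExpr = PState → Bool

  infixr 5 _⨾_
  infixr 4 _⊕_
  data Cmd : Set where
    skip   : Cmd
    _≔_    : PVars → Expr → Cmd
    havoc  : PVars → Cmd
    assume : BExpr → Cmd
    _⨾_    : Cmd → Cmd → Cmd
    _⊕_    : Cmd → Cmd → Cmd
    _*     : Cmd → Cmd

  -- σ' is the state σ[x ↦ v]  (stated relationally, no decidable equality needed)
  Updated : PState → PVars → PVals → PState → Set
  Updated σ x v σ' = ∀ y → (y ≡ x → σ' y ≡ v) × (¬ (y ≡ x) → σ' y ≡ σ y)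

  data ⟨_,_⟩⇓_ : Cmd → PState → PState → Set where
    ⇓skip    : ∀ {σ} → ⟨ skip , σ ⟩⇓ σ
    ⇓assign  : ∀ {x e σ σ'} → Updated σ x (e σ) σ' → ⟨ x ≔ e , σ ⟩⇓ σ'
    ⇓havoc   : ∀ {x σ σ'} (v : PVals) → Updated σ x v σ' → ⟨ havoc x , σ ⟩⇓ σ'
    ⇓assume  : ∀ {b σ} → b σ ≡ true → ⟨ assume b , σ ⟩⇓ σ
    ⇓seq     : ∀ {C₁ C₂ σ σ' σ''} → ⟨ C₁ , σ ⟩⇓ σ' → ⟨ C₂ , σ' ⟩⇓ σ'' → ⟨ C₁ ⨾ C₂ , σ ⟩⇓ σ''
    ⇓choiceˡ : ∀ {C₁ C₂ σ σ'} → ⟨ C₁ , σ ⟩⇓ σ' → ⟨ C₁ ⊕ C₂ , σ ⟩⇓ σ'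
    ⇓choiceʳ : ∀ {C₁ C₂ σ σ'} → ⟨ C₂ , σ ⟩⇓ σ' → ⟨ C₁ ⊕ C₂ , σ ⟩⇓ σ'
    ⇓star₀   : ∀ {C σ} → ⟨ C * , σ ⟩⇓ σ
    ⇓star₁   : ∀ {C σ σ' σ''} → ⟨ C , σ ⟩⇓ σ' → ⟨ C * , σ' ⟩⇓ σ'' → ⟨ C * , σ ⟩⇓ σ''

  -- sets are predicates (Relation.Unary), equal when extensionally equal (_≐_)
  -- sem(C,S) = { φ | ∃σ. (φᴸ,σ) ∈ S ∧ ⟨C,σ⟩ → φᴾ }
  sem : Cmd → Pred ExtState 0ℓ → Pred ExtState 0ℓ
  sem C S φ = ∃ λ σ → S (proj₁ φ , σ) × ⟨ C , σ ⟩⇓ proj₂ φ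

  HyperAssertion : Set₁
  HyperAssertion = Pred (Pred ExtState 0ℓ) 0ℓ

  -- a hyper-assertion is a function on *sets*: it respects extensional equality
  ExtensionalHA : HyperAssertion → Set₁
  ExtensionalHA A = ∀ {S S'} → S ≐ S' → A S → A S'

  ⊨⟨_⟩_⟨_⟩ : HyperAssertion → Cmd → HyperAssertion → Set₁
  ⊨⟨ P ⟩ C ⟨ Q ⟩ = ∀ (S : Pred ExtState 0ℓ) → P S → Q (sem C S)

  Hyperproperty : Set₁
  Hyperproperty = Pred (Pred (PState × PState) 0ℓ) 0ℓ

  -- a hyperproperty is a set of *sets*: membership respects extensional equality
  ExtensionalHP : Hyperproperty → Set₁
  ExtensionalHP H = ∀ {R R'} → R ≐ R' → H R → H R'

  ioRel : Cmd → Pred (PState × PState) 0ℓ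
  ioRel C (σ , σ') = ⟨ C , σ ⟩⇓ σ'

  Satisfies : Cmd → Hyperproperty → Set
  Satisfies C H = H (ioRel C)

{-# OPTIONS --safe #-}
module Submission where

-- Copy each initial program state σ into the logical variables, via an injective
-- encoding tag : PState → LState. The precondition P says that the set of extended
-- states contains every σ exactly once, tagged as (tag σ , σ). After running C,
-- the tag still remembers the initial state, so the final set is the input/output
-- relation of C in disguise, and the postcondition Q asks that this relation lies in H.

open import Defs
open import Level using (0ℓ)
open import Data.Product using (_×_; Σ-syntax; _,_)
open import Function.Base using (_∘_)
open import Function.Bundles using (_↪_; _⇔_; mk⇔; RightInverse)
open import Function.Definitions using (Injective)
open import Axiom.Extensionality.Propositional using (Extensionality)
open import Relation.Binary.PropositionalEquality using (_≡_; refl; cong; sym; trans; subst)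
open import Relation.Unary using (Pred; _⊆_; _≐_)
open import Relation.Unary.Properties using (≐-sym)

module StateEncoding {PVars PVals LVars LVals : Set}
    (ext : Extensionality 0ℓ 0ℓ) (F : PVars ↪ LVars) (G : PVals ↪ LVals) where
  open HHL PVars PVals LVars LVals
  module F = RightInverse F
  module G = RightInverse G

  encode : PState → LState
  encode σ y = G.to (σ (F.from y))

  decode : LState → PState
  decode l x = G.from (l (F.to x))

  decode-encode : ∀ σ → decode (encode σ) ≡ σ
  decode-encode σ = ext λ x →
    trans (G.strictlyInverseʳ (σ (F.from (F.to x)))) (cong σ (F.strictlyInverseʳ x))

  encode-injective : Injective _≡_ _≡_ encode
  encode-injective {σ} {σ'} e =
    trans (sym (decode-encode σ)) (trans (cong decode e) (decode-encode σ'))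

module Tagging {PVars PVals LVars LVals : Set}
    (tag : HHL.PState PVars PVals LVars LVals → HHL.LState PVars PVals LVars LVals) where
  open HHL PVars PVals LVars LVals

  IsTagging : HyperAssertion
  IsTagging S = (∀ {l σ} → S (l , σ) → l ≡ tag σ) × (∀ σ → S (tag σ , σ))

  allTagged : Pred ExtState 0ℓ
  allTagged (l , σ) = l ≡ tag σ

  allTagged-isTagging : IsTagging allTagged
  allTagged-isTagging = (λ e → e) , (λ σ → refl)

  untag : Pred ExtState 0ℓ → Pred (PState × PState) 0ℓ
  untag S (σ , σ') = S (tag σ , σ')

  isTagging-extensional : ExtensionalHA IsTagging
  isTagging-extensional (S⊆S' , S'⊆S) (tagged , complete) =
    tagged ∘ S'⊆S , S⊆S' ∘ complete

  untag-extensional : ∀ {H} → ExtensionalHP H → ExtensionalHA (H ∘ untag)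
  untag-extensional extH (S⊆S' , S'⊆S) = extH (S⊆S' , S'⊆S)

  ioRel⊆untag-sem : ∀ C {S} → IsTagging S → ioRel C ⊆ untag (sem C S)
  ioRel⊆untag-sem C (_ , complete) {σ , _} run = σ , complete σ , run

  untag-sem⊆ioRel : Injective _≡_ _≡_ tag →
                    ∀ C {S} → IsTagging S → untag (sem C S) ⊆ ioRel C
  untag-sem⊆ioRel tag-injective C (tagged , _) {σ , σ'} (σ₀ , s , run) =
    subst (λ τ → ⟨ C , τ ⟩⇓ σ') (tag-injective (sym (tagged s))) run

  ioRel≐untag-sem : Injective _≡_ _≡_ tag →
                    ∀ C {S} → IsTagging S → ioRel C ≐ untag (sem C S)
  ioRel≐untag-sem tag-injective C S-tagging =
    ioRel⊆untag-sem C S-tagging , untag-sem⊆ioRel tag-injective C S-tagging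

  satisfies⇔tagged-triple : Injective _≡_ _≡_ tag → ∀ {H} → ExtensionalHP H →
                            ∀ C → Satisfies C H ⇔ ⊨⟨ IsTagging ⟩ C ⟨ H ∘ untag ⟩
  satisfies⇔tagged-triple tag-injective extH C = mk⇔
    (λ sat S S-tagging → extH (ioRel≐untag-sem tag-injective C S-tagging) sat)
    (λ valid → extH (≐-sym (ioRel≐untag-sem tag-injective C allTagged-isTagging))
                    (valid allTagged allTagged-isTagging))

mainTheorem4 : {PVars PVals LVars LVals : Set}
    → Extensionality 0ℓ 0ℓ
    → PVars ↪ LVars
    → PVals ↪ LVals
    → (H : HHL.Hyperproperty PVars PVals LVars LVals)
    → HHL.ExtensionalHP PVars PVals LVars LVals H
    → Σ[ P ∈ HHL.HyperAssertion PVars PVals LVars LVals ]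
    Σ[ Q ∈ HHL.HyperAssertion PVars PVals LVars LVals ]
    ( HHL.ExtensionalHA PVars PVals LVars LVals P
    × HHL.ExtensionalHA PVars PVals LVars LVals Q
    × ((C : HHL.Cmd PVars PVals LVars LVals)
    → HHL.Satisfies PVars PVals LVars LVals C H
    ⇔ HHL.⊨⟨_⟩_⟨_⟩ PVars PVals LVars LVals P C Q) )
mainTheorem4 ext F G H extH =
    IsTagging , H ∘ untag
  , isTagging-extensional , untag-extensional extH
  , satisfies⇔tagged-triple encode-injective extH
  where
  open StateEncoding ext F G
  open Tagging encode
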